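{- Let $H=(V,E)$ be a hypergraph with edge family $(e_i)_{i\in I}$, all hyperedges nonempty. Then $\kappa(H;x,y,\mathbf{t})=\xi(H;0,x,xy,\mathbf{t})$ (with the convention $0^0=1$).
   Context: A hypergraph $H=(V,E)$ has finite vertex set $V$ and finite indexed family $E=(e_i)_{i\in I}$ of subsets of $V$ (parallel edges allowed); here all hyperedges are nonempty. For $J\subseteq I$, $H_J=(V,(e_j)_{j\in J})$ is the partial hypergraph and $H\times J$ the edge section hypergraph with vertex set $\bigcup_{j\in J}e_j$ and edges $(e_j)_{j\in J}$. $k(G)$ denotes the number of connected components of a hypergraph $G$ (a hypergraph without vertices has $0$). A pair $(A,B)$ of disjoint subsets of $I$ is vertex disjoint if $e_a\cap e_b=\emptyset$ for all $a\in A,b\in B$. The multivariate hyperedge elimination polynomial is $\xi(H;x,y,z,\mathbf{t})=\sum_{(A,B)}x^{k(H_{A\sqcup B})-k(H\times B)}y^{|A|+|B|-k(H\times B)}z^{k(H\times B)}\prod_{i\in A\sqcup B}t_i$, summed over vertex disjoint pairs. A hyperedge covering is a set $C\subseteq I$ with $\bigcup_{i\in C}e_i=V$. The multivariate hyperedge covering polynomial is $\kappa(H;x,y,\mathbf{t})=\sum_C x^{|C|}y^{k(H_C)}\prod_{i\in C}t_i$, summed over all hyperedge coverings (so it is $0$ if some vertex lies in no hyperedge). -}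

module Defs where

open import Data.Nat.Base using (ℕ; zero; suc; _∸_) renaming (_+_ to _+ℕ_)
open import Data.Bool.Base using (Bool; true; false; _∧_; _∨_; not; if_then_else_)
open import Data.Fin.Base using (Fin; _<_) renaming (zero to fzero; suc to fsuc)
open import Data.Fin.Properties using (_<?_)
open import Data.Fin.Subset using (Subset; ⊤; ⁅_⁆; _∪_; _∩_; ⋃; ∣_∣; Nonempty)
open import Data.Vec.Base as Vec using (Vec; []; _∷_; lookup; allFin; toList)
open import Data.List.Base as List using (List; []; _∷_; filterᵇ; cartesianProduct; map; foldr)
open import Data.Product.Base using (_×_; _,_)
open import Relation.Nullary.Decidable.Core using (does)
open import Algebra.Bundles using (CommutativeRing)
import Algebra.Definitions.RawSemiring as RawSemiringDefs
open import Algebra.Bundles using (Semiring)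
open import Data.Bool.ListAction using (any)

-- Hypergraphs with vertex set V = Fin n and edge family (e_i)_{i ∈ I},
-- I = Fin m (parallel edges allowed: the family is an arbitrary function).

record Hypergraph (n m : ℕ) : Set where
  field
    edge : Fin m → Subset n

open Hypergraph public

AllEdgesNonempty : ∀ {n m} → Hypergraph n m → Set
AllEdgesNonempty {m = m} H = (i : Fin m) → Nonempty (edge H i)

anyB : ∀ {n} → Subset n → Bool
anyB []       = false
anyB (b ∷ bs) = b ∨ anyB bs

allB : ∀ {n} → Subset n → Bool
allB []       = true
allB (b ∷ bs) = b ∧ allB bs

meets : ∀ {n} → Subset n → Subset n → Bool
meets p q = anyB (p ∩ q)

elems : ∀ {m} → Subset m → List (Fin m)
elems {m} J = filterᵇ (lookup J) (toList (allFin m))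

allSubsets : (m : ℕ) → List (Subset m)
allSubsets zero    = Vec.[] ∷ []
allSubsets (suc m) = map (true Vec.∷_) (allSubsets m) List.++ map (false Vec.∷_) (allSubsets m)

edgeUnion : ∀ {n m} → Hypergraph n m → Subset m → Subset n
edgeUnion H J = ⋃ (map (edge H) (elems J))

step : ∀ {n m} → Hypergraph n m → Subset m → Subset n → Subset n
step H J S = S ∪ ⋃ (map (edge H) (filterᵇ (λ j → meets (edge H j) S) (elems J)))

iter : ∀ {A : Set} → ℕ → (A → A) → A → A
iter zero    f a = a
iter (suc k) f a = f (iter k f a)

-- set of vertices reachable from u (n steps suffice, as |V| = n)
reach : ∀ {n m} → Hypergraph n m → Subset m → Fin n → Subset n
reach {n} H J u = iter n (step H J) ⁅ u ⁆

connected : ∀ {n m} → Hypergraph n m → Subset m → Fin n → Fin n → Bool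
connected H J u v = lookup (reach H J u) v

-- Number of connected components of the hypergraph with vertex set W
-- and edges (e_j)_{j ∈ J} (where every e_j ⊆ W): each component is
-- counted once, via its least vertex.
isLeast : ∀ {n m} → Hypergraph n m → Subset m → Subset n → Fin n → Bool
isLeast {n} H J W v =
  lookup W v ∧
  not (anyB (Vec.map (λ u → does (u <? v) ∧ lookup W u ∧ connected H J u v) (allFin n)))

components : ∀ {n m} → Hypergraph n m → Subset n → Subset m → ℕ
components {n} H W J = List.length (filterᵇ (λ v → isLeast H J W v) (toList (allFin n)))

kPartial : ∀ {n m} → Hypergraph n m → Subset m → ℕ
kPartial H J = components H ⊤ J

kSection : ∀ {n m} → Hypergraph n m → Subset m → ℕ
kSection H J = components H (edgeUnion H J) J

vertexDisjoint : ∀ {n m} → Hypergraph n m → Subset m → Subset m → Bool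
vertexDisjoint H A B =
  not (anyB (A ∩ B)) ∧
  not (any (λ a → any (λ b → meets (edge H a) (edge H b)) (elems B)) (elems A))

isCovering : ∀ {n m} → Hypergraph n m → Subset m → Bool
isCovering H C = allB (edgeUnion H C)

-- The two polynomials, evaluated in an arbitrary commutative ring
-- (an identity of polynomials with integer coefficients).

module Polys {c ℓ} (R : CommutativeRing c ℓ) where
  open CommutativeRing R
  open RawSemiringDefs (Semiring.rawSemiring semiring) using (_^_)

  sumL : List Carrier → Carrier
  sumL = foldr _+_ 0#

  prodT : ∀ {m} → (Fin m → Carrier) → Subset m → Carrier
  prodT t J = foldr _*_ 1# (map t (elems J))

  xi : ∀ {n m} → Hypergraph n m → Carrier → Carrier → Carrier → (Fin m → Carrier) → Carrier
  xi {m = m} H x y z t =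
    sumL (map term (filterᵇ (λ p → vertexDisjoint H (fst p) (snd p))
                           (cartesianProduct (allSubsets m) (allSubsets m))))
    where
    fst : Subset m × Subset m → Subset m
    fst (A , B) = A
    snd : Subset m × Subset m → Subset m
    snd (A , B) = B
    term : Subset m × Subset m → Carrier
    term (A , B) =
      x ^ (kPartial H (A ∪ B) ∸ kSection H B) *
      y ^ (∣ A ∣ +ℕ ∣ B ∣ ∸ kSection H B) *
      z ^ (kSection H B) *
      prodT t (A ∪ B)

  kappa : ∀ {n m} → Hypergraph n m → Carrier → Carrier → (Fin m → Carrier) → Carrier
  kappa {m = m} H x y t =
    sumL (map (λ C → x ^ ∣ C ∣ * y ^ (kPartial H C) * prodT t C)
              (filterᵇ (λ C → isCovering H C) (allSubsets m)))

module Submission where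

-- Every summand of ξ(H; 0, x, xy, t) carries the factor 0 ^ (k(H_{A ⊔ B}) ∸ k(H × B)).
-- Counting components by their least vertices, each component of H × B is also one of
-- H_{A ⊔ B}, and a vertex outside U = ⋃_{b ∈ B} e_b adds a further one.  Such a vertex
-- exists when A ≠ ∅ (its edges are nonempty and, by vertex disjointness, miss U) or when
-- B is not a covering, so only the pairs (∅, C) with C a covering survive.  For them
-- H × C = H_C, and as k(H_C) ≤ |C| the summand is x ^ (|C| ∸ k) (xy) ^ k t_C = x ^ |C| y ^ k t_C
-- with k = k(H_C), the summand of κ.

open import Defs
open import Data.Nat.Base using (ℕ)
open import Data.Fin.Base using (Fin)
open import Algebra.Bundles using (CommutativeRing)

open import Data.Nat.Base as ℕ using (zero; suc; z≤n; s≤s; _∸_)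
import Data.Nat.Properties as ℕ
open import Data.Bool.Base using (Bool; true; false; T; _∧_; not; if_then_else_)
open import Data.Bool.Properties using (T-∧; T-∨; T-≡; T?)
open import Data.Empty using (⊥-elim)
open import Data.Fin.Base using (_<_) renaming (zero to fzero; suc to fsuc)
open import Data.Fin.Properties using (_<?_; <-cmp; suc-injective)
open import Data.Fin.Induction using (<-wellFounded)
open import Data.Fin.Subset using (Subset; inside; outside; ⊤; ⊥; ⁅_⁆; _∪_; _∩_; ⋃; ∣_∣;
  _∈_; _∉_; _⊆_; _⊂_; _-_; Nonempty; Empty)
open import Data.Fin.Subset.Properties using (∉⊥; ∈⊤; x∈⁅x⁆; x∈⁅y⁆⇒x≡y; drop-there;
  x∈p∪q⁺; x∈p∪q⁻; x∈p∩q⁺; x∈p∩q⁻; _∈?_; p─q⊆p; ∣⊥∣≡0; ∪-identityˡ; x∈p∧x≢y⇒x∈p-y; x∈p⇒∣p-x∣<∣p∣;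
  p⊂q⇒∣p∣<∣q∣)
open import Data.Vec.Base as Vec using (Vec; []; _∷_; here; there; lookup; allFin; toList)
open import Data.Vec.Properties using (lookup-map; lookup-allFin)
open import Data.Vec.Membership.Propositional.Properties using (∈-toList⁺; ∈-allFin⁺)
open import Data.List.Base as List using (List; []; _∷_; filterᵇ; map; length; cartesianProduct; _++_)
import Data.List.Properties as List
open import Data.List.Relation.Unary.Any using (Any; here; there)
import Data.List.Relation.Unary.Any.Properties as Any
open import Data.List.Relation.Unary.Any.Properties using (any⁺; any⁻)
open import Data.Bool.ListAction using (any)
open import Data.List.Membership.Propositional using (find; lose) renaming (_∈_ to _∈ₗ_)
open import Data.List.Membership.Propositional.Properties using (∈-filter⁺; ∈-filter⁻)
open import Data.Product.Base using (_×_; _,_; ∃; proj₁; proj₂)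
import Data.Product.Base as Product
open import Data.Sum.Base using (_⊎_; inj₁; inj₂; [_,_]′)
open import Data.Unit.Base using (tt)
open import Function.Base using (_∘_; id; case_of_)
open import Function.Bundles using (Equivalence)
open import Induction.WellFounded using (Acc; acc)
open import Relation.Binary.Definitions using (tri<; tri≈; tri>)
open import Relation.Binary.PropositionalEquality using (_≡_; refl; sym; cong; subst; subst₂)
import Relation.Binary.PropositionalEquality as ≡
open import Relation.Nullary using (¬_; Dec; yes; no; contradiction)
open import Relation.Nullary.Decidable using (map′; dec-true; does)

open Equivalence using (to; from)
import Relation.Binary.Reasoning.Setoid

private variable
  n m : ℕ

T-lookup⁺ : ∀ {p : Subset n} {x} → x ∈ p → T (lookup p x)
T-lookup⁺ here        = tt
T-lookup⁺ (there x∈p) = T-lookup⁺ x∈p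

T-lookup⁻ : ∀ (p : Subset n) x → T (lookup p x) → x ∈ p
T-lookup⁻ (true ∷ p) fzero    _ = here
T-lookup⁻ (_    ∷ p) (fsuc x) t = there (T-lookup⁻ p x t)

T-anyB⁺ : ∀ {p : Subset n} {x} → x ∈ p → T (anyB p)
T-anyB⁺ here                    = tt
T-anyB⁺ {p = b ∷ _} (there x∈p) = from T-∨ (inj₂ (T-anyB⁺ x∈p))

T-anyB⁻ : ∀ (p : Subset n) → T (anyB p) → Nonempty p
T-anyB⁻ (true  ∷ p) _ = fzero , here
T-anyB⁻ (false ∷ p) t = Product.map fsuc there (T-anyB⁻ p t)

T-allB⁻ : ∀ (p : Subset n) → T (allB p) → p ≡ ⊤
T-allB⁻ []         _ = refl
T-allB⁻ (true ∷ p) t = cong (inside ∷_) (T-allB⁻ p t)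

¬T-allB⁻ : ∀ (p : Subset n) → ¬ T (allB p) → ∃ λ x → x ∉ p
¬T-allB⁻ []          ¬t = ⊥-elim (¬t tt)
¬T-allB⁻ (true  ∷ p) ¬t = Product.map fsuc (_∘ drop-there) (¬T-allB⁻ p ¬t)
¬T-allB⁻ (false ∷ p) _  = fzero , λ ()

T-meets⁺ : ∀ {p q : Subset n} {x} → x ∈ p → x ∈ q → T (meets p q)
T-meets⁺ x∈p x∈q = T-anyB⁺ (x∈p∩q⁺ (x∈p , x∈q))

T-meets⁻ : ∀ (p q : Subset n) → T (meets p q) → ∃ λ x → x ∈ p × x ∈ q
T-meets⁻ p q t = Product.map₂ (x∈p∩q⁻ p q) (T-anyB⁻ (p ∩ q) t)

T-not⇒¬T : ∀ {b} → T (not b) → ¬ T b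
T-not⇒¬T {true} ()

¬T⇒T-not : ∀ {b} → ¬ T b → T (not b)
¬T⇒T-not {true}  ¬t = ¬t tt
¬T⇒T-not {false} _  = tt

T-does⁻ : ∀ {P : Set} (d : Dec P) → T (does d) → P
T-does⁻ (yes p) _ = p

T-does⁺ : ∀ {P : Set} (d : Dec P) → P → T (does d)
T-does⁺ d p = from T-≡ (dec-true d p)

∈-map-allFin⁺ : ∀ (f : Fin n → Bool) {x} → T (f x) → x ∈ Vec.map f (allFin n)
∈-map-allFin⁺ {n} f {x} t = T-lookup⁻ _ x
  (subst T (sym (lookup-map x f (allFin n))) (subst (T ∘ f) (sym (lookup-allFin x)) t))

∈-map-allFin⁻ : ∀ (f : Fin n → Bool) {x} → x ∈ Vec.map f (allFin n) → T (f x)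
∈-map-allFin⁻ {n} f {x} x∈ =
  subst (T ∘ f) (lookup-allFin x) (subst T (lookup-map x f (allFin n)) (T-lookup⁺ x∈))

length-filterᵇ-toList : ∀ {A : Set} (f : A → Bool) (xs : Vec A n) →
  length (filterᵇ f (toList xs)) ≡ ∣ Vec.map f xs ∣
length-filterᵇ-toList f []       = refl
length-filterᵇ-toList f (x ∷ xs) with f x
... | true  = cong suc (length-filterᵇ-toList f xs)
... | false = length-filterᵇ-toList f xs

⁅⁆⊆ : ∀ {P : Fin n → Set} {u} → P u → ∀ {v} → v ∈ ⁅ u ⁆ → P v
⁅⁆⊆ {P = P} {u} Pu v∈⁅u⁆ = subst P (sym (x∈⁅y⁆⇒x≡y u v∈⁅u⁆)) Pu

∈-⋃⁺ : ∀ {ps : List (Subset n)} {x} → Any (x ∈_) ps → x ∈ ⋃ ps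
∈-⋃⁺ (here x∈p)   = x∈p∪q⁺ (inj₁ x∈p)
∈-⋃⁺ (there x∈ps) = x∈p∪q⁺ (inj₂ (∈-⋃⁺ x∈ps))

∈-⋃⁻ : ∀ (ps : List (Subset n)) {x} → x ∈ ⋃ ps → Any (x ∈_) ps
∈-⋃⁻ []       x∈ = contradiction x∈ ∉⊥
∈-⋃⁻ (p ∷ ps) x∈ = [ here , there ∘ ∈-⋃⁻ ps ]′ (x∈p∪q⁻ p (⋃ ps) x∈)

∈-elems⁺ : ∀ {J : Subset m} {i} → i ∈ J → i ∈ₗ elems J
∈-elems⁺ {J = J} {i} i∈J = ∈-filter⁺ (T? ∘ lookup J) (∈-toList⁺ (∈-allFin⁺ i)) (T-lookup⁺ i∈J)

∈-elems⁻ : ∀ (J : Subset m) {i} → i ∈ₗ elems J → i ∈ J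
∈-elems⁻ {m} J {i} i∈ =
  T-lookup⁻ J i (proj₂ (∈-filter⁻ (T? ∘ lookup J) {xs = toList (allFin m)} i∈))

module _ (H : Hypergraph n m) where

  ∈-edgeUnion⁺ : ∀ {J j v} → j ∈ J → v ∈ edge H j → v ∈ edgeUnion H J
  ∈-edgeUnion⁺ j∈J v∈e = ∈-⋃⁺ (Any.map⁺ (lose (∈-elems⁺ j∈J) v∈e))

  ∈-edgeUnion⁻ : ∀ {J v} → v ∈ edgeUnion H J → ∃ λ j → j ∈ J × v ∈ edge H j
  ∈-edgeUnion⁻ {J} v∈ with j , j∈ , v∈e ← find (Any.map⁻ (∈-⋃⁻ (map (edge H) (elems J)) v∈)) =
    j , ∈-elems⁻ J j∈ , v∈e

  ⊆-step : ∀ J {S} → S ⊆ step H J S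
  ⊆-step J = x∈p∪q⁺ ∘ inj₁

  ∈-step⁺ : ∀ {J S j u v} → j ∈ J → u ∈ edge H j → u ∈ S → v ∈ edge H j → v ∈ step H J S
  ∈-step⁺ j∈J u∈e u∈S v∈e = x∈p∪q⁺ (inj₂ (∈-⋃⁺ (Any.map⁺ (lose
    (∈-filter⁺ _ (∈-elems⁺ j∈J) (T-meets⁺ u∈e u∈S)) v∈e))))

  ∈-step⁻ : ∀ {J S v} → v ∈ step H J S →
    v ∈ S ⊎ ∃ λ j → j ∈ J × (∃ λ u → u ∈ edge H j × u ∈ S) × v ∈ edge H j
  ∈-step⁻ {J} {S} v∈ with x∈p∪q⁻ S _ v∈
  ... | inj₁ v∈S = inj₁ v∈S
  ... | inj₂ v∈⋃ with j , j∈ , v∈e ← find (Any.map⁻ (∈-⋃⁻ (map (edge H) _) v∈⋃))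
                  with j∈elems , meet ← ∈-filter⁻ (λ j → T? (meets (edge H j) S)) {xs = elems J} j∈ =
    inj₂ (j , ∈-elems⁻ J j∈elems , T-meets⁻ (edge H j) S meet , v∈e)

  ⊆-iter-step : ∀ J {S} k → S ⊆ iter k (step H J) S
  ⊆-iter-step J zero    = id
  ⊆-iter-step J (suc k) = ⊆-step J ∘ ⊆-iter-step J k

  EdgeClosed : Subset m → (Fin n → Set) → Set
  EdgeClosed J P = ∀ {j v w} → j ∈ J → v ∈ edge H j → w ∈ edge H j → P v → P w

  EdgeClosed-¬ : ∀ {J P} → EdgeClosed J P → EdgeClosed J (¬_ ∘ P)
  EdgeClosed-¬ closed j∈J v∈e w∈e ¬Pv Pw = ¬Pv (closed j∈J w∈e v∈e Pw)

  iter-step-closed : ∀ {J P S} → EdgeClosed J P → (∀ {v} → v ∈ S → P v) →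
    ∀ k {v} → v ∈ iter k (step H J) S → P v
  iter-step-closed closed S⊆P zero    = S⊆P
  iter-step-closed closed S⊆P (suc k) v∈ with ∈-step⁻ v∈
  ... | inj₁ v∈S = iter-step-closed closed S⊆P k v∈S
  ... | inj₂ (j , j∈J , (u , u∈e , u∈S) , v∈e) =
    closed j∈J u∈e v∈e (iter-step-closed closed S⊆P k u∈S)

  reach-closed : ∀ {J P u v} → EdgeClosed J P → P u → v ∈ reach H J u → P v
  reach-closed closed Pu =
    iter-step-closed closed (⁅⁆⊆ Pu) n

  iter-step-restrict : ∀ {J} K {P S} → EdgeClosed J P →
    (∀ {j v} → j ∈ J → v ∈ edge H j → P v → j ∈ K) → (∀ {v} → v ∈ S → P v) →
    ∀ k → iter k (step H J) S ⊆ iter k (step H K) S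
  iter-step-restrict K closed toK S⊆P zero    v∈ = v∈
  iter-step-restrict K closed toK S⊆P (suc k) v∈ with ∈-step⁻ v∈
  ... | inj₁ v∈S = ⊆-step K (iter-step-restrict K closed toK S⊆P k v∈S)
  ... | inj₂ (j , j∈J , (u , u∈e , u∈S) , v∈e) =
    ∈-step⁺ (toK j∈J u∈e (iter-step-closed closed S⊆P k u∈S)) u∈e
            (iter-step-restrict K closed toK S⊆P k u∈S) v∈e

  reach-restrict : ∀ {J} K {P u} → EdgeClosed J P →
    (∀ {j v} → j ∈ J → v ∈ edge H j → P v → j ∈ K) → P u → reach H J u ⊆ reach H K u
  reach-restrict K closed toK Pu =
    iter-step-restrict K closed toK (⁅⁆⊆ Pu) n


edge⊆reach : ∀ (H : Hypergraph n m) {J j u v} → j ∈ J → u ∈ edge H j → v ∈ edge H j →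
  v ∈ reach H J u
edge⊆reach {suc n} H {J} {u = u} j∈J u∈e v∈e =
  ∈-step⁺ H j∈J u∈e (⊆-iter-step H J n (x∈⁅x⁆ u)) v∈e

injection⇒∣p∣≤∣q∣ : ∀ {p : Subset n} {q : Subset m} (R : Fin n → Fin m → Set) →
  (∀ {x} → x ∈ p → ∃ λ y → y ∈ q × R x y) →
  (∀ {x x′ y} → x ∈ p → x′ ∈ p → y ∈ q → R x y → R x′ y → x ≡ x′) → ∣ p ∣ ℕ.≤ ∣ q ∣
injection⇒∣p∣≤∣q∣ {p = []} R image injective = z≤n
injection⇒∣p∣≤∣q∣ {p = outside ∷ p} R image injective =
  injection⇒∣p∣≤∣q∣ (R ∘ fsuc) (image ∘ there) 
    (λ x∈p x′∈p y∈q Rx Rx′ → suc-injective (injective (there x∈p) (there x′∈p) y∈q Rx Rx′))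
injection⇒∣p∣≤∣q∣ {p = inside ∷ p} {q} R image injective
  with y₀ , y₀∈q , Ry₀ ← image here =
  ℕ.≤-trans (s≤s (injection⇒∣p∣≤∣q∣ (R ∘ fsuc) image′ injective′)) (x∈p⇒∣p-x∣<∣p∣ y₀∈q)
  where
  image′ : ∀ {x} → x ∈ p → ∃ λ y → y ∈ q - y₀ × R (fsuc x) y
  image′ x∈p with y , y∈q , Ry ← image (there x∈p) =
    y , x∈p∧x≢y⇒x∈p-y y∈q (λ { refl → case injective here (there x∈p) y₀∈q Ry₀ Ry of λ () }) , Ry
  injective′ : ∀ {x x′ y} → x ∈ p → x′ ∈ p → y ∈ q - y₀ → R (fsuc x) y → R (fsuc x′) y → x ≡ x′
  injective′ x∈p x′∈p y∈q-y₀ Rx Rx′ =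
    suc-injective (injective (there x∈p) (there x′∈p) (p─q⊆p q ⁅ y₀ ⁆ y∈q-y₀) Rx Rx′)

module _ (H : Hypergraph n m) where

  Dominated : Subset m → Subset n → Fin n → Set
  Dominated J W v = ∃ λ u → u < v × u ∈ W × v ∈ reach H J u

  IsLeast : Subset m → Subset n → Fin n → Set
  IsLeast J W v = v ∈ W × ¬ Dominated J W v

  isDominator : Subset m → Subset n → Fin n → Fin n → Bool
  isDominator J W v u = does (u <? v) ∧ lookup W u ∧ connected H J u v

  dominators : Subset m → Subset n → Fin n → Subset n
  dominators J W v = Vec.map (isDominator J W v) (allFin n)

  T-anyB-dominators⁺ : ∀ J W v → Dominated J W v → T (anyB (dominators J W v))
  T-anyB-dominators⁺ J W v (u , u<v , u∈W , v∈reach) = T-anyB⁺ (∈-map-allFin⁺ (isDominator J W v)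
    (from T-∧ (T-does⁺ (u <? v) u<v , from T-∧ (T-lookup⁺ u∈W , T-lookup⁺ v∈reach))))

  T-anyB-dominators⁻ : ∀ J W v → T (anyB (dominators J W v)) → Dominated J W v
  T-anyB-dominators⁻ J W v t with u , u∈ ← T-anyB⁻ _ t
    with u<v , rest ← to T-∧ (∈-map-allFin⁻ (isDominator J W v) u∈)
    with u∈W , v∈reach ← to T-∧ rest =
    u , T-does⁻ (u <? v) u<v , T-lookup⁻ W u u∈W , T-lookup⁻ (reach H J u) v v∈reach

  dominated? : ∀ J W v → Dec (Dominated J W v)
  dominated? J W v =
    map′ (T-anyB-dominators⁻ J W v) (T-anyB-dominators⁺ J W v) (T? (anyB (dominators J W v)))

  leastVertices : Subset m → Subset n → Subset n
  leastVertices J W = Vec.map (isLeast H J W) (allFin n)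

  components≡∣leastVertices∣ : ∀ W J → components H W J ≡ ∣ leastVertices J W ∣
  components≡∣leastVertices∣ W J = length-filterᵇ-toList (isLeast H J W) (allFin n)

  ∈-leastVertices⁺ : ∀ J W {v} → IsLeast J W v → v ∈ leastVertices J W
  ∈-leastVertices⁺ J W {v} (v∈W , ¬dom) =
    ∈-map-allFin⁺ (isLeast H J W)
      (from T-∧ (T-lookup⁺ v∈W , ¬T⇒T-not (¬dom ∘ T-anyB-dominators⁻ J W v)))

  ∈-leastVertices⁻ : ∀ J W {v} → v ∈ leastVertices J W → IsLeast J W v
  ∈-leastVertices⁻ J W {v} v∈ with v∈W , ¬dom ← to T-∧ (∈-map-allFin⁻ (isLeast H J W) v∈) =
    T-lookup⁻ W v v∈W , T-not⇒¬T ¬dom ∘ T-anyB-dominators⁺ J W v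

  -- Descend along smaller dominators; they stay outside W because W is J-closed.
  ∃-least-outside : ∀ {J W v} → EdgeClosed H J (_∈ W) → v ∉ W →
    ∃ λ w → w ∉ W × IsLeast J ⊤ w
  ∃-least-outside {J} {W} {v} closed = go (<-wellFounded v)
    where
    go : ∀ {v} → Acc _<_ v → v ∉ W → ∃ λ w → w ∉ W × IsLeast J ⊤ w
    go {v} (acc smaller) v∉W with dominated? J ⊤ v
    ... | no ¬dom = v , v∉W , ∈⊤ , ¬dom
    ... | yes (u , u<v , _ , v∈reach) =
      go (smaller u<v) (λ u∈W → v∉W (reach-closed H closed u∈W v∈reach))

  IsLeast-edge-unique : ∀ {J W j v v′} → IsLeast J W v → IsLeast J W v′ →
    j ∈ J → v ∈ edge H j → v′ ∈ edge H j → v ≡ v′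
  IsLeast-edge-unique {v = v} {v′} (v∈W , ¬dom) (v′∈W , ¬dom′) j∈J v∈e v′∈e with <-cmp v v′
  ... | tri< v<v′ _ _ = contradiction (v , v<v′ , v∈W , edge⊆reach H j∈J v∈e v′∈e) ¬dom′
  ... | tri≈ _ v≡v′ _ = v≡v′
  ... | tri> _ _ v′<v = contradiction (v′ , v′<v , v′∈W , edge⊆reach H j∈J v′∈e v∈e) ¬dom

  -- each component of H × B contains an edge of B, and distinct components distinct ones
  kSection≤∣∣ : ∀ B → kSection H B ℕ.≤ ∣ B ∣
  kSection≤∣∣ B = subst (ℕ._≤ ∣ B ∣) (sym (components≡∣leastVertices∣ U B))
    (injection⇒∣p∣≤∣q∣ {q = B} (λ v b → v ∈ edge H b)
      (∈-edgeUnion⁻ H ∘ proj₁ ∘ ∈-leastVertices⁻ B U)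
      (λ v∈ v′∈ → IsLeast-edge-unique (∈-leastVertices⁻ B U v∈) (∈-leastVertices⁻ B U v′∈)))
    where U = edgeUnion H B

kSection≡kPartial : ∀ (H : Hypergraph n m) C → T (isCovering H C) → kSection H C ≡ kPartial H C
kSection≡kPartial H C covering = cong (λ W → components H W C) (T-allB⁻ (edgeUnion H C) covering)

VertexDisjoint : Hypergraph n m → Subset m → Subset m → Set
VertexDisjoint H A B = ∀ {a b v} → a ∈ A → b ∈ B → v ∈ edge H a → v ∉ edge H b

module _ (H : Hypergraph n m) {A B : Subset m} where

  T-vertexDisjoint⁻ : T (vertexDisjoint H A B) → VertexDisjoint H A B
  T-vertexDisjoint⁻ t a∈A b∈B v∈a v∈b = T-not⇒¬T (proj₂ (to T-∧ t))
    (any⁺ _ (lose (∈-elems⁺ a∈A) (any⁺ _ (lose (∈-elems⁺ b∈B) (T-meets⁺ v∈a v∈b)))))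

  T-vertexDisjoint⁺ : Empty (A ∩ B) → VertexDisjoint H A B → T (vertexDisjoint H A B)
  T-vertexDisjoint⁺ empty disjoint =
    from T-∧ (¬T⇒T-not (empty ∘ T-anyB⁻ (A ∩ B)) , ¬T⇒T-not edgesMeet)
    where
    edgesMeet : ¬ T (any (λ a → any (λ b → meets (edge H a) (edge H b)) (elems B)) (elems A))
    edgesMeet t with a , a∈ , t′ ← find (any⁻ _ (elems A) t)
                with b , b∈ , t″ ← find (any⁻ _ (elems B) t′)
                with v , v∈a , v∈b ← T-meets⁻ (edge H a) (edge H b) t″ =
      disjoint (∈-elems⁻ A a∈) (∈-elems⁻ B b∈) v∈a v∈b

⊥-vertexDisjoint : ∀ (H : Hypergraph n m) {B} → VertexDisjoint H ⊥ B
⊥-vertexDisjoint H a∈⊥ = contradiction a∈⊥ ∉⊥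

T-vertexDisjoint-⊥ : ∀ (H : Hypergraph n m) B → T (vertexDisjoint H ⊥ B)
T-vertexDisjoint-⊥ H B = T-vertexDisjoint⁺ H (∉⊥ ∘ proj₁ ∘ x∈p∩q⁻ ⊥ B ∘ proj₂) (⊥-vertexDisjoint H)

module _ (H : Hypergraph n m) (A B : Subset m) (disjoint : VertexDisjoint H A B) where

  private
    U : Subset n
    U = edgeUnion H B

  ∉-edgeUnion : ∀ {a v} → a ∈ A → v ∈ edge H a → v ∉ U
  ∉-edgeUnion a∈A v∈e v∈U with b , b∈B , v∈b ← ∈-edgeUnion⁻ H v∈U = disjoint a∈A b∈B v∈e v∈b

  edgeUnion-closed : EdgeClosed H (A ∪ B) (_∈ U)
  edgeUnion-closed j∈A∪B v∈e w∈e v∈U with x∈p∪q⁻ A B j∈A∪B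
  ... | inj₁ j∈A = contradiction v∈U (∉-edgeUnion j∈A v∈e)
  ... | inj₂ j∈B = ∈-edgeUnion⁺ H j∈B w∈e

  ∈B-of-meeting-edgeUnion : ∀ {j v} → j ∈ A ∪ B → v ∈ edge H j → v ∈ U → j ∈ B
  ∈B-of-meeting-edgeUnion j∈A∪B v∈e v∈U with x∈p∪q⁻ A B j∈A∪B
  ... | inj₁ j∈A = contradiction v∈U (∉-edgeUnion j∈A v∈e)
  ... | inj₂ j∈B = j∈B

  IsLeast-section⇒IsLeast-partial : ∀ {v} → IsLeast H B U v → IsLeast H (A ∪ B) ⊤ v
  IsLeast-section⇒IsLeast-partial (v∈U , ¬dom) = ∈⊤ , λ where
    (u , u<v , _ , v∈reach) → case u ∈? U of λ where
      (yes u∈U) → ¬dom (u , u<v , u∈U ,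
        reach-restrict H B edgeUnion-closed ∈B-of-meeting-edgeUnion u∈U v∈reach)
      (no u∉U) → reach-closed H (EdgeClosed-¬ H edgeUnion-closed) u∉U v∈reach v∈U

  leastVertices-⊂ : ∀ {v} → v ∉ U → leastVertices H B U ⊂ leastVertices H (A ∪ B) ⊤
  leastVertices-⊂ v∉U with w , w∉U , w-least ← ∃-least-outside H edgeUnion-closed v∉U =
    ∈-leastVertices⁺ H (A ∪ B) ⊤ ∘ IsLeast-section⇒IsLeast-partial ∘ ∈-leastVertices⁻ H B U ,
    w , ∈-leastVertices⁺ H (A ∪ B) ⊤ w-least , w∉U ∘ proj₁ ∘ ∈-leastVertices⁻ H B U

  kSection<kPartial : ∀ {v} → v ∉ U → kSection H B ℕ.< kPartial H (A ∪ B)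
  kSection<kPartial v∉U = subst₂ ℕ._<_
    (sym (components≡∣leastVertices∣ H U B)) (sym (components≡∣leastVertices∣ H ⊤ (A ∪ B)))
    (p⊂q⇒∣p∣<∣q∣ (leastVertices-⊂ v∉U))

module RingLemmas {c ℓ} (R : CommutativeRing c ℓ) where

  open CommutativeRing R renaming (refl to ≈-refl; sym to ≈-sym; trans to ≈-trans)
  open Polys R using (sumL)
  open import Algebra.Properties.CommutativeSemiring.Exp commutativeSemiring
    using (_^_; ^-homo-*; ^-distrib-*)
  open import Relation.Binary.Reasoning.Setoid setoid

  infix 5 _when_

  _when_ : Carrier → Bool → Carrier
  a when b = if b then a else 0#

  sumL-cong : ∀ {X : Set} {f g : X → Carrier} → (∀ a → f a ≈ g a) →
    ∀ xs → sumL (map f xs) ≈ sumL (map g xs)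
  sumL-cong f≈g []       = ≈-refl
  sumL-cong f≈g (a ∷ xs) = +-cong (f≈g a) (sumL-cong f≈g xs)

  sumL-zero : ∀ {X : Set} {f : X → Carrier} → (∀ a → f a ≈ 0#) → ∀ xs → sumL (map f xs) ≈ 0#
  sumL-zero f≈0 []       = ≈-refl
  sumL-zero f≈0 (a ∷ xs) = ≈-trans (+-cong (f≈0 a) (sumL-zero f≈0 xs)) (+-identityˡ 0#)

  sumL-++ : ∀ as bs → sumL (as ++ bs) ≈ sumL as + sumL bs
  sumL-++ []       bs = ≈-sym (+-identityˡ _)
  sumL-++ (a ∷ as) bs = ≈-trans (+-congˡ (sumL-++ as bs)) (≈-sym (+-assoc _ _ _))

  sumL-map-++ : ∀ {X : Set} (f : X → Carrier) xs ys →
    sumL (map f (xs ++ ys)) ≈ sumL (map f xs) + sumL (map f ys)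
  sumL-map-++ f xs ys =
    ≈-trans (reflexive (cong sumL (List.map-++ f xs ys))) (sumL-++ (map f xs) (map f ys))

  sumL-filterᵇ : ∀ {X : Set} (f : X → Carrier) (p : X → Bool) xs →
    sumL (map f (filterᵇ p xs)) ≈ sumL (map (λ a → f a when p a) xs)
  sumL-filterᵇ f p []       = ≈-refl
  sumL-filterᵇ f p (a ∷ xs) with p a
  ... | true  = +-congˡ (sumL-filterᵇ f p xs)
  ... | false = ≈-trans (sumL-filterᵇ f p xs) (≈-sym (+-identityˡ _))

  sumL-cartesianProduct : ∀ {X Y : Set} (f : X × Y → Carrier) xs ys →
    sumL (map f (cartesianProduct xs ys)) ≈ sumL (map (λ a → sumL (map (λ b → f (a , b)) ys)) xs)
  sumL-cartesianProduct f []       ys = ≈-refl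
  sumL-cartesianProduct f (a ∷ xs) ys = begin
    sumL (map f (map (a ,_) ys ++ cartesianProduct xs ys))
      ≈⟨ sumL-map-++ f (map (a ,_) ys) (cartesianProduct xs ys) ⟩
    sumL (map f (map (a ,_) ys)) + sumL (map f (cartesianProduct xs ys))
      ≈⟨ +-cong (reflexive (cong sumL (≡.sym (List.map-∘ ys)))) (sumL-cartesianProduct f xs ys) ⟩
    sumL (map (λ b → f (a , b)) ys) + sumL (map (λ a → sumL (map (λ b → f (a , b)) ys)) xs) ∎

  sumL-allSubsets : ∀ {m} (f : Subset m → Carrier) → (∀ A → Nonempty A → f A ≈ 0#) →
    sumL (map f (allSubsets m)) ≈ f ⊥
  sumL-allSubsets {zero}  f f≈0 = +-identityʳ _
  sumL-allSubsets {suc m} f f≈0 = begin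
    sumL (map f (map (inside ∷_) (allSubsets m) ++ map (outside ∷_) (allSubsets m)))
      ≈⟨ sumL-map-++ f (map (inside ∷_) (allSubsets m)) _ ⟩
    sumL (map f (map (inside ∷_) (allSubsets m))) + sumL (map f (map (outside ∷_) (allSubsets m)))
      ≈⟨ +-cong (reflexive (cong sumL (List.map-∘ (allSubsets m))))
                (reflexive (cong sumL (List.map-∘ (allSubsets m)))) ⟨
    sumL (map (f ∘ (inside ∷_)) (allSubsets m)) + sumL (map (f ∘ (outside ∷_)) (allSubsets m))
      ≈⟨ +-cong (sumL-zero (λ A → f≈0 (inside ∷ A) (fzero , here)) (allSubsets m))
                (sumL-allSubsets (f ∘ (outside ∷_))
                  λ A (x , x∈A) → f≈0 (outside ∷ A) (fsuc x , there x∈A)) ⟩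
    0# + f ⊥
      ≈⟨ +-identityˡ _ ⟩
    f ⊥ ∎

  0^-positive : ∀ {k} → 0 ℕ.< k → 0# ^ k ≈ 0#
  0^-positive {suc k} _ = zeroˡ _

  ^-∸-split : ∀ x y {a k} → k ℕ.≤ a → x ^ (a ∸ k) * (x * y) ^ k ≈ x ^ a * y ^ k
  ^-∸-split x y {a} {k} k≤a = begin
    x ^ (a ∸ k) * (x * y) ^ k    ≈⟨ *-congˡ (^-distrib-* x y k) ⟩
    x ^ (a ∸ k) * (x ^ k * y ^ k) ≈⟨ *-assoc _ _ _ ⟨
    x ^ (a ∸ k) * x ^ k * y ^ k   ≈⟨ *-congʳ (^-homo-* x (a ∸ k) k) ⟨
    x ^ (a ∸ k ℕ.+ k) * y ^ k     ≡⟨ ≡.cong (λ e → x ^ e * y ^ k) (ℕ.m∸n+n≡m k≤a) ⟩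
    x ^ a * y ^ k                 ∎

module Summands {c ℓ} (R : CommutativeRing c ℓ) (H : Hypergraph n m)
  (x y : CommutativeRing.Carrier R) (t : Fin m → CommutativeRing.Carrier R) where

  open CommutativeRing R renaming (refl to ≈-refl; sym to ≈-sym; trans to ≈-trans)
  open Polys R using (prodT)
  open RingLemmas R using (_when_; 0^-positive; ^-∸-split)
  open import Algebra.Properties.CommutativeSemiring.Exp commutativeSemiring using (_^_)
  open import Relation.Binary.Reasoning.Setoid setoid

  ξSummand : Subset m × Subset m → Carrier
  ξSummand (A , B) =
    0# ^ (kPartial H (A ∪ B) ∸ kSection H B) *
    x ^ (∣ A ∣ ℕ.+ ∣ B ∣ ∸ kSection H B) *
    (x * y) ^ kSection H B *
    prodT t (A ∪ B)

  κSummand : Subset m → Carrier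
  κSummand C = x ^ ∣ C ∣ * y ^ kPartial H C * prodT t C

  disjointPair : Subset m × Subset m → Bool
  disjointPair (A , B) = vertexDisjoint H A B

  ξSummand-vanishes : ∀ A B → kSection H B ℕ.< kPartial H (A ∪ B) → ξSummand (A , B) ≈ 0#
  ξSummand-vanishes A B lt = begin
    _ ≈⟨ *-congʳ (*-congʳ (*-congʳ (0^-positive (ℕ.m<n⇒0<n∸m lt)))) ⟩
    0# * _ * _ * _ ≈⟨ *-congʳ (*-congʳ (zeroˡ _)) ⟩
    0# * _ * _ ≈⟨ *-congʳ (zeroˡ _) ⟩
    0# * _ ≈⟨ zeroˡ _ ⟩
    0# ∎

  ξSummand-nonempty : AllEdgesNonempty H → ∀ {A} B → Nonempty A →
    ξSummand (A , B) when disjointPair (A , B) ≈ 0#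
  ξSummand-nonempty nonempty {A} B (a , a∈A) with vertexDisjoint H A B in disjoint
  ... | false = ≈-refl
  ... | true with w , w∈a ← nonempty a =
    ξSummand-vanishes A B
      (kSection<kPartial H A B disjoint′ (∉-edgeUnion H A B disjoint′ a∈A w∈a))
    where disjoint′ = T-vertexDisjoint⁻ H (from T-≡ disjoint)

  ξSummand-⊥ : ∀ B → ξSummand (⊥ , B) when disjointPair (⊥ , B) ≈ κSummand B when isCovering H B
  ξSummand-⊥ B rewrite to T-≡ (T-vertexDisjoint-⊥ H B)
    with isCovering H B in covering
  ... | false with v , v∉U ← ¬T-allB⁻ (edgeUnion H B) (λ t → subst T covering t) =
    ξSummand-vanishes ⊥ B (kSection<kPartial H ⊥ B (⊥-vertexDisjoint H) v∉U)
  ... | true = begin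
    ξSummand (⊥ , B)
      ≡⟨ ≡.cong₂ (λ C k′ → 0# ^ (kPartial H C ∸ k′) * x ^ (∣ ⊥ {m} ∣ ℕ.+ ∣ B ∣ ∸ k′) *
                           (x * y) ^ k′ * prodT t C)
                 (∪-identityˡ B) (kSection≡kPartial H B (from T-≡ covering)) ⟩
    0# ^ (k ∸ k) * x ^ (∣ ⊥ {m} ∣ ℕ.+ ∣ B ∣ ∸ k) * (x * y) ^ k * prodT t B
      ≡⟨ ≡.cong₂ (λ e d → 0# ^ e * x ^ (d ℕ.+ ∣ B ∣ ∸ k) * (x * y) ^ k * prodT t B)
                 (ℕ.n∸n≡0 k) (∣⊥∣≡0 m) ⟩
    1# * x ^ (∣ B ∣ ∸ k) * (x * y) ^ k * prodT t B
      ≈⟨ *-congʳ (≈-trans (*-congʳ (*-identityˡ _)) (^-∸-split x y k≤∣B∣)) ⟩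
    κSummand B ∎
    where
    k = kPartial H B
    k≤∣B∣ : k ℕ.≤ ∣ B ∣
    k≤∣B∣ = subst (ℕ._≤ ∣ B ∣) (kSection≡kPartial H B (from T-≡ covering)) (kSection≤∣∣ H B)

mainTheorem8 : ∀ {c ℓ} (R : CommutativeRing c ℓ) {n m : ℕ} (H : Hypergraph n m) →
    AllEdgesNonempty H →
    let open CommutativeRing R in
    (x y : Carrier) (t : Fin m → Carrier) →
    Polys.kappa R H x y t ≈ Polys.xi R H 0# x (x * y) t
mainTheorem8 R {m = m} H nonempty x y t = begin
  kappa H x y t
    ≈⟨ sumL-filterᵇ κSummand (isCovering H) S ⟩
  sumL (map (λ B → κSummand B when isCovering H B) S)
    ≈⟨ sumL-cong ξSummand-⊥ S ⟨
  sumL (map (λ B → ξSummand (⊥ , B) when disjointPair (⊥ , B)) S)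
    ≈⟨ sumL-allSubsets ξ-row (λ A A≠∅ → sumL-zero (λ B → ξSummand-nonempty nonempty B A≠∅) S) ⟨
  sumL (map ξ-row S)
    ≈⟨ sumL-cartesianProduct (λ p → ξSummand p when disjointPair p) S S ⟨
  sumL (map (λ p → ξSummand p when disjointPair p) (cartesianProduct S S))
    ≈⟨ sumL-filterᵇ ξSummand disjointPair (cartesianProduct S S) ⟨
  xi H 0# x (x * y) t ∎
  where
  open CommutativeRing R using (setoid; 0#; _*_; Carrier)
  open Relation.Binary.Reasoning.Setoid setoid
  open Polys R using (sumL; kappa; xi)
  open RingLemmas R
  open Summands R H x y t
  S = allSubsets m
  ξ-row : Subset m → Carrier
  ξ-row A = sumL (map (λ B → ξSummand (A , B) when disjointPair (A , B)) S)
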